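{- Let $\psi$ be a cyclic formula whose root is a $\Box$-occurrence. Then $\mathsf{GL}^\circ\vdash\psi\leftrightarrow\langle\psi/\top\rangle$.
   Context: Labels: $\bot,\top$ and propositional variables (arity 0), $\neg,\Box$ (arity 1), $\wedge,\vee,\to$ (arity 2). A graph is $\langle V,r,S,\lambda\rangle$ with $V$ finite, root $r$, labelling $\lambda$, $S:V\to V^{*}$ ordered successors (length = arity of label); every vertex reachable from $r$. A vertex labelled $\Box$ is a $\Box$-occurrence. A cycle is a set of pairwise distinct vertices $a_0,\dots,a_{k-1}$ with $a_{j+1}$ a successor of $a_j$ and $a_0$ a successor of $a_{k-1}$. A (cyclic) formula is a graph in which every cycle contains a $\Box$-occurrence. Bisimulation: $aRa'$ implies equal labels and $i$-th successors related; $\simeq$ = bisimilarity relating roots. $\phi[p:\chi]$: disjoint union identifying each $p$-labelled vertex of $\phi$ with the root of $\chi$ (keeping that root's label). For $p$ not in $\psi$: if the root $r$ of $\psi$ is on no cycle, $\langle\psi/p\rangle:=\psi$; otherwise add a fresh vertex labelled $p$ without successors and redirect every edge into $r$ to it (root still $r$). $\langle\psi/\top\rangle:=\langle\psi/p\rangle[p:\top]$. $\mathsf{CHL}$: least set of cyclic formulas containing all substitution instances of propositional tautologies, all $\Box(\phi\to\chi)\to(\Box\phi\to\Box\chi)$, all $\phi\leftrightarrow\chi$ with $\phi\simeq\chi$, closed under modus ponens, necessitation and Löb's rule (from $\vdash\Box\phi\to\phi$ infer $\vdash\phi$). $\mathsf{GL}^\circ$ is $\mathsf{CHL}$ extended with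 all instances of $\Box\phi\to\Box\Box\phi$, closed under the same rules. -}

module Defs where

open import Data.Nat using (ℕ; zero; suc; _+_)
open import Data.Bool using (Bool; true; false; not; _∧_; _∨_)
open import Data.Fin using (Fin; zero; suc; _↑ˡ_; _↑ʳ_; splitAt; inject₁; fromℕ; _≟_)
open import Data.Vec using (Vec; []; _∷_; map)
open import Data.Vec.Membership.Propositional using (_∈_)
open import Data.Vec.Relation.Binary.Pointwise.Inductive using (Pointwise)
open import Data.Sum using (_⊎_; inj₁; inj₂)
open import Data.Product using (Σ; ∃; _×_)
open import Relation.Binary.PropositionalEquality using (_≡_)
open import Relation.Nullary using (¬_; yes; no)
open import Function.Definitions using (Injective)

data Label : Set where
  lbot ltop : Label
  lvar      : ℕ → Label
  lneg lbox : Label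
  land lor limp : Label

arity : Label → ℕ
arity lbot     = 0
arity ltop     = 0
arity (lvar _) = 0
arity lneg     = 1
arity lbox     = 1
arity land     = 2
arity lor      = 2
arity limp     = 2

record Graph : Set where
  field
    size  : ℕ
    root  : Fin size
    label : Fin size → Label
    succ  : (v : Fin size) → Vec (Fin size) (arity (label v))
open Graph public

Edge : (G : Graph) → Fin (size G) → Fin (size G) → Set
Edge G a b = b ∈ succ G a

data Reach (G : Graph) : Fin (size G) → Fin (size G) → Set where
  here : ∀ {v} → Reach G v v
  step : ∀ {u w v} → Edge G u w → Reach G w v → Reach G u v

record Cycle (G : Graph) : Set where
  field
    len   : ℕ
    vs    : Fin (suc len) → Fin (size G)
    inj   : Injective _≡_ _≡_ vs
    links : (j : Fin len) → Edge G (vs (inject₁ j)) (vs (suc j))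
    close : Edge G (vs (fromℕ len)) (vs zero)
open Cycle public

IsFormula : Graph → Set
IsFormula G =
  ((v : Fin (size G)) → Reach G (root G) v) ×
  ((c : Cycle G) → ∃ λ j → label G (vs c j) ≡ lbox)

IsBisimulation : (G H : Graph) → (Fin (size G) → Fin (size H) → Set) → Set
IsBisimulation G H R =
  ∀ a a' → R a a' →
    (label G a ≡ label H a') × Pointwise R (succ G a) (succ H a')

_≃_ : Graph → Graph → Set₁
G ≃ H = Σ (Fin (size G) → Fin (size H) → Set) λ R →
          IsBisimulation G H R × R (root G) (root H)

data Op0 : Set where
  obot otop : Op0
  ovar : ℕ → Op0

data Op1 : Set where
  oneg obox : Op1

data Op2 : Set where
  oand oor oimp : Op2

lab0 : Op0 → Label
lab0 obot     = lbot
lab0 otop     = ltop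
lab0 (ovar p) = lvar p

lab1 : Op1 → Label
lab1 oneg = lneg
lab1 obox = lbox

lab2 : Op2 → Label
lab2 oand = land
lab2 oor  = lor
lab2 oimp = limp

succ0 : ∀ {A : Set} (o : Op0) → Vec A (arity (lab0 o))
succ0 obot     = []
succ0 otop     = []
succ0 (ovar _) = []

succ1 : ∀ {A : Set} (o : Op1) → A → Vec A (arity (lab1 o))
succ1 oneg x = x ∷ []
succ1 obox x = x ∷ []

succ2 : ∀ {A : Set} (o : Op2) → A → A → Vec A (arity (lab2 o))
succ2 oand x y = x ∷ y ∷ []
succ2 oor  x y = x ∷ y ∷ []
succ2 oimp x y = x ∷ y ∷ []

node0 : Op0 → Graph
node0 o = record
  { size = 1 ; root = zero ; label = λ _ → lab0 o ; succ = λ _ → succ0 o }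

node1 : Op1 → Graph → Graph
node1 o G = record { size = suc (size G) ; root = zero ; label = lb ; succ = sc }
  where
  lb : Fin (suc (size G)) → Label
  lb zero    = lab1 o
  lb (suc v) = label G v
  sc : (v : Fin (suc (size G))) → Vec (Fin (suc (size G))) (arity (lb v))
  sc zero    = succ1 o (suc (root G))
  sc (suc v) = map suc (succ G v)

node2 : Op2 → Graph → Graph → Graph
node2 o G H = record { size = suc (n + m) ; root = zero ; label = lb ; succ = sc }
  where
  n = size G
  m = size H
  lb' : Fin n ⊎ Fin m → Label
  lb' (inj₁ v) = label G v
  lb' (inj₂ w) = label H w
  sc' : (x : Fin n ⊎ Fin m) → Vec (Fin (n + m)) (arity (lb' x))
  sc' (inj₁ v) = map (_↑ˡ m) (succ G v)
  sc' (inj₂ w) = map (n ↑ʳ_) (succ H w)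
  lb : Fin (suc (n + m)) → Label
  lb zero    = lab2 o
  lb (suc k) = lb' (splitAt n k)
  sc : (v : Fin (suc (n + m))) → Vec (Fin (suc (n + m))) (arity (lb v))
  sc zero    = succ2 o (suc (root G ↑ˡ m)) (suc (n ↑ʳ root H))
  sc (suc k) = map suc (sc' (splitAt n k))

□_ : Graph → Graph
□ G = node1 obox G

_⇒_ : Graph → Graph → Graph
G ⇒ H = node2 oimp G H

_⇔_ : Graph → Graph → Graph
G ⇔ H = node2 oand (G ⇒ H) (H ⇒ G)

infixr 6 _⇒_
infix 5 _⇔_
infix 7 □_

data PForm : Set where
  pvar : ℕ → PForm
  pbot ptop : PForm
  pneg : PForm → PForm
  pand por pimp : PForm → PForm → PForm

eval : (ℕ → Bool) → PForm → Bool
eval v (pvar p)   = v p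
eval v pbot       = false
eval v ptop       = true
eval v (pneg A)   = not (eval v A)
eval v (pand A B) = eval v A ∧ eval v B
eval v (por A B)  = eval v A ∨ eval v B
eval v (pimp A B) = not (eval v A) ∨ eval v B

Tautology : PForm → Set
Tautology A = (v : ℕ → Bool) → eval v A ≡ true

inst : (ℕ → Graph) → PForm → Graph
inst σ (pvar p)   = σ p
inst σ pbot       = node0 obot
inst σ ptop       = node0 otop
inst σ (pneg A)   = node1 oneg (inst σ A)
inst σ (pand A B) = node2 oand (inst σ A) (inst σ B)
inst σ (por A B)  = node2 oor (inst σ A) (inst σ B)
inst σ (pimp A B) = node2 oimp (inst σ A) (inst σ B)

data Derivable (Ax : Graph → Set₁) : Graph → Set₁ where
  taut  : (A : PForm) → Tautology A → (σ : ℕ → Graph) →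
          IsFormula (inst σ A) → Derivable Ax (inst σ A)
  kax   : (φ χ : Graph) → IsFormula (□ (φ ⇒ χ) ⇒ (□ φ ⇒ □ χ)) →
          Derivable Ax (□ (φ ⇒ χ) ⇒ (□ φ ⇒ □ χ))
  bisim : (φ χ : Graph) → φ ≃ χ → IsFormula (φ ⇔ χ) →
          Derivable Ax (φ ⇔ χ)
  extra : (φ : Graph) → Ax φ → IsFormula φ → Derivable Ax φ
  mp    : {φ χ : Graph} → Derivable Ax φ → Derivable Ax (φ ⇒ χ) →
          IsFormula χ → Derivable Ax χ
  nec   : {φ : Graph} → Derivable Ax φ → IsFormula (□ φ) →
          Derivable Ax (□ φ)
  löb   : {φ : Graph} → Derivable Ax (□ φ ⇒ φ) → IsFormula φ →
          Derivable Ax φ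

NoAx : Graph → Set₁
NoAx _ = Data.Empty.Polymorphic.⊥
  where import Data.Empty.Polymorphic

data Four : Graph → Set₁ where
  four : (φ : Graph) → Four (□ φ ⇒ □ □ φ)

CHL⊢_ : Graph → Set₁
CHL⊢ φ = Derivable NoAx φ

GL°⊢_ : Graph → Set₁
GL°⊢ φ = Derivable Four φ

RootOnCycle : Graph → Set
RootOnCycle G = Σ (Cycle G) λ c → ∃ λ j → vs c j ≡ root G

-- add a fresh vertex labelled ℓ (of arity 0) without successors and
-- redirect every edge into the root to it; the root stays the root.
-- The fresh vertex is `zero`, old vertex v becomes `suc v`.
redirect : Op0 → Graph → Graph
redirect o G = record
  { size = suc (size G) ; root = suc (root G) ; label = lb ; succ = sc }
  where
  lb : Fin (suc (size G)) → Label
  lb zero    = lab0 o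
  lb (suc v) = label G v
  f : Fin (size G) → Fin (suc (size G))
  f w with w ≟ root G
  ... | yes _ = zero
  ... | no  _ = suc w
  sc : (v : Fin (suc (size G))) → Vec (Fin (suc (size G))) (arity (lb v))
  sc zero    = succ0 o
  sc (suc v) = map f (succ G v)

-- ⟨ψ/p⟩ (for p not occurring in ψ), as a relation ψ ↦ result
data SubVar (p : ℕ) (ψ : Graph) : Graph → Set where
  onCycle  : RootOnCycle ψ → SubVar p ψ (redirect (ovar p) ψ)
  offCycle : ¬ RootOnCycle ψ → SubVar p ψ ψ

-- ⟨ψ/⊤⟩ := ⟨ψ/p⟩[p:⊤]: identifying the (unique) fresh p-vertex with the
-- root of the one-vertex formula ⊤ yields the fresh vertex labelled ⊤.
data SubTop (ψ : Graph) : Graph → Set where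
  onCycle  : RootOnCycle ψ → SubTop ψ (redirect otop ψ)
  offCycle : ¬ RootOnCycle ψ → SubTop ψ ψ

-- Write χ for ⟨ψ/⊤⟩; for a vertex u of ψ let ψᵤ be the subformula of ψ at u and χᵤ the
-- subformula of χ at the corresponding vertex, the fresh ⊤-vertex when u is the root.
-- As the root of ψ is a □-occurrence, ψ is bisimilar to □ψₛ for its successor s, so
-- axiom 4 yields ψ → □ψ. Assuming □(ψ → ⋀ᵤ (ψᵤ ↔ χᵤ)) and ψ, every ψᵤ ↔ χᵤ follows by
-- well-founded induction along the edges leaving non-□ vertices (well-founded because
-- every cycle contains a □-occurrence): at the root both sides are equivalent to ⊤ by ψ,
-- below a □ the assumption gives the boxed equivalence, and elsewhere propositional
-- congruence suffices. Löb's rule turns this into ⊢ ψ → ⋀ᵤ (ψᵤ ↔ χᵤ); boxing it gives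
-- □ψ → (ψ ↔ χ), hence ψ → χ via ψ → □ψ, and χ → ψ by Löb's rule once more, now using
-- χ → □χ.

module Submission where

open import Defs
open import Data.Bool using (Bool; true; false; _∧_; T)
open import Data.Bool.Properties using (T-∧; T-≡)
open import Data.Empty using (⊥; ⊥-elim)
open import Data.Fin using (Fin; zero; suc; toℕ; inject₁; fromℕ; _↑ˡ_; _↑ʳ_; splitAt; _≟_)
open import Data.Fin.Properties using (splitAt-↑ˡ; splitAt-↑ʳ; splitAt⁻¹-↑ˡ; splitAt⁻¹-↑ʳ; any?; pigeonhole; toℕ-injective; toℕ<n; toℕ-inject₁; toℕ-fromℕ)
open import Data.List using (List; []; _∷_)
open import Data.Nat using (ℕ; zero; suc; _+_; _∸_; _≤_; _<_; s≤s; _≤?_)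
open import Data.Nat.Properties using (anyUpTo?; ≤-reflexive; ≤-trans; ≤-pred; <⇒≤; ≰⇒>; <-irrefl; <-≤-trans; ≤-<-trans; n<1+n; m≤n⇒m<n∨m≡n; +-suc; +-identityʳ; +-cancelˡ-≡; m≤m+n; m≤n+m; +-monoʳ-≤; +-monoˡ-<; m+[n∸m]≡n)
open import Data.Nat.Induction using (<-wellFounded)
open import Data.Product using (∃; _×_; _,_; proj₁; proj₂)
open import Data.Sum using (_⊎_; inj₁; inj₂; [_,_]; reduce)
open import Data.Vec using (Vec; []; _∷_; map)
open import Data.Vec.Membership.Propositional using (_∈_; find; lose)
open import Data.Vec.Membership.Propositional.Properties using (∈-map⁺)
open import Data.Vec.Relation.Unary.Any as Any using (here; there)
open import Data.Vec.Relation.Binary.Pointwise.Inductive as Pointwise using (Pointwise; []; _∷_)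
open import Data.Unit using (⊤; tt)
open import Function using (_∘_; Equivalence)
open import Induction.WellFounded using (Acc; acc; WellFounded)
open import Relation.Binary.PropositionalEquality hiding ([_])
open import Relation.Nullary using (¬_; yes; no; Dec; contradiction)

module _ {A B : Set} {R : A → B → Set} where

  Pointwise-∈ˡ : ∀ {m k} {xs : Vec A m} {ys : Vec B k} {x} →
                 Pointwise R xs ys → x ∈ xs → ∃ λ y → y ∈ ys × R x y
  Pointwise-∈ˡ (r ∷ rs) (here refl) = _ , here refl , r
  Pointwise-∈ˡ (r ∷ rs) (there x∈) with Pointwise-∈ˡ rs x∈
  ... | y , y∈ , rxy = y , there y∈ , rxy

  Pointwise-∈ʳ : ∀ {m k} {xs : Vec A m} {ys : Vec B k} {y} →
                 Pointwise R xs ys → y ∈ ys → ∃ λ x → x ∈ xs × R x y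
  Pointwise-∈ʳ (r ∷ rs) (here refl) = _ , here refl , r
  Pointwise-∈ʳ (r ∷ rs) (there y∈) with Pointwise-∈ʳ rs y∈
  ... | x , x∈ , rxy = x , there x∈ , rxy

  Pointwise-mapˡ : ∀ {C : Set} (f : C → A) {m k} {xs : Vec C m} {ys : Vec B k} →
                   Pointwise (λ x y → R (f x) y) xs ys → Pointwise R (map f xs) ys
  Pointwise-mapˡ f []       = []
  Pointwise-mapˡ f (r ∷ rs) = r ∷ Pointwise-mapˡ f rs

  Pointwise-mapʳ : ∀ {C : Set} (f : C → B) {m k} {xs : Vec A m} {ys : Vec C k} →
                   Pointwise (λ x y → R x (f y)) xs ys → Pointwise R xs (map f ys)
  Pointwise-mapʳ f []       = []
  Pointwise-mapʳ f (r ∷ rs) = r ∷ Pointwise-mapʳ f rs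

Pointwise-diagonal : ∀ {A : Set} {R : A → A → Set} {m} (xs : Vec A m) →
                     (∀ {x} → x ∈ xs → R x x) → Pointwise R xs xs
Pointwise-diagonal []       r = []
Pointwise-diagonal (x ∷ xs) r = r (here refl) ∷ Pointwise-diagonal xs (r ∘ there)

Pointwise-≡-∈ : ∀ {A : Set} {m k} {xs : Vec A m} {ys : Vec A k} {x} →
                Pointwise _≡_ xs ys → x ∈ xs → x ∈ ys
Pointwise-≡-∈ p x∈ with Pointwise-∈ˡ p x∈
... | _ , y∈ , refl = y∈

module _ {A B : Set} {R : A → B → Set} where

  succ1-pointwise : (o : Op1) {a : A} {b : B} → R a b → Pointwise R (succ1 o a) (succ1 o b)
  succ1-pointwise oneg r = r ∷ []
  succ1-pointwise obox r = r ∷ []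

  succ2-pointwise : (o : Op2) {a c : A} {b d : B} → R a b → R c d →
                    Pointwise R (succ2 o a c) (succ2 o b d)
  succ2-pointwise oand r s = r ∷ s ∷ []
  succ2-pointwise oor  r s = r ∷ s ∷ []
  succ2-pointwise oimp r s = r ∷ s ∷ []

module _ {A : Set} where

  ∉-succ0 : (o : Op0) {x : A} → ¬ x ∈ succ0 o
  ∉-succ0 obot     ()
  ∉-succ0 otop     ()
  ∉-succ0 (ovar _) ()

  ∈-succ1 : (o : Op1) {a : A} → a ∈ succ1 o a
  ∈-succ1 oneg = here refl
  ∈-succ1 obox = here refl

  ∈-succ1⁻ : (o : Op1) {a x : A} → x ∈ succ1 o a → x ≡ a
  ∈-succ1⁻ oneg (here refl) = refl
  ∈-succ1⁻ obox (here refl) = refl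

  ∈-succ2ˡ : (o : Op2) {a b : A} → a ∈ succ2 o a b
  ∈-succ2ˡ oand = here refl
  ∈-succ2ˡ oor  = here refl
  ∈-succ2ˡ oimp = here refl

  ∈-succ2ʳ : (o : Op2) {a b : A} → b ∈ succ2 o a b
  ∈-succ2ʳ oand = there (here refl)
  ∈-succ2ʳ oor  = there (here refl)
  ∈-succ2ʳ oimp = there (here refl)

  ∈-succ2⁻ : (o : Op2) {a b x : A} → x ∈ succ2 o a b → x ≡ a ⊎ x ≡ b
  ∈-succ2⁻ oand (here refl)         = inj₁ refl
  ∈-succ2⁻ oand (there (here refl)) = inj₂ refl
  ∈-succ2⁻ oor  (here refl)         = inj₁ refl
  ∈-succ2⁻ oor  (there (here refl)) = inj₂ refl
  ∈-succ2⁻ oimp (here refl)         = inj₁ refl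
  ∈-succ2⁻ oimp (there (here refl)) = inj₂ refl

lab2≢lbox : (o : Op2) → lab2 o ≢ lbox
lab2≢lbox oand ()
lab2≢lbox oor  ()
lab2≢lbox oimp ()

data Shape {n : ℕ} (l : Label) (xs : Vec (Fin n) (arity l)) : Set where
  nullary : (o : Op0) → l ≡ lab0 o → Shape l xs
  unary   : (o : Op1) (w : Fin n) → l ≡ lab1 o → Pointwise _≡_ (succ1 o w) xs → Shape l xs
  binary  : (o : Op2) (w₁ w₂ : Fin n) → l ≡ lab2 o →
            Pointwise _≡_ (succ2 o w₁ w₂) xs → Shape l xs

shapeOf : ∀ {n} (l : Label) (xs : Vec (Fin n) (arity l)) → Shape l xs
shapeOf lbot     []           = nullary obot refl
shapeOf ltop     []           = nullary otop refl
shapeOf (lvar p) []           = nullary (ovar p) refl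
shapeOf lneg     (x ∷ [])     = unary oneg x refl (refl ∷ [])
shapeOf lbox     (x ∷ [])     = unary obox x refl (refl ∷ [])
shapeOf land     (x ∷ y ∷ []) = binary oand x y refl (refl ∷ refl ∷ [])
shapeOf lor      (x ∷ y ∷ []) = binary oor  x y refl (refl ∷ refl ∷ [])
shapeOf limp     (x ∷ y ∷ []) = binary oimp x y refl (refl ∷ refl ∷ [])

shape : (G : Graph) (u : Fin (size G)) → Shape (label G u) (succ G u)
shape G u = shapeOf (label G u) (succ G u)

succ0-nullary : ∀ {n} {l : Label} (xs : Vec (Fin n) (arity l)) (o : Op0) → l ≡ lab0 o →
                ∀ {A : Set} {R : A → Fin n → Set} → Pointwise R (succ0 o) xs
succ0-nullary [] obot     refl = []
succ0-nullary [] otop     refl = []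
succ0-nullary [] (ovar _) refl = []

-- Bisimulations and homomorphisms

≃-sym : ∀ {G H : Graph} → G ≃ H → H ≃ G
≃-sym {G} {H} (R , isBisim , roots) = (λ b a → R a b) , isBisim′ , roots
  where
  isBisim′ : IsBisimulation H G (λ b a → R a b)
  isBisim′ b a r = let l , p = isBisim a b r in sym l , Pointwise.sym (λ r′ → r′) p

≃-trans : ∀ {G H K : Graph} → G ≃ H → H ≃ K → G ≃ K
≃-trans {G} {H} {K} (R , isR , r₁) (S , isS , r₂) = RS , isRS , (_ , r₁ , r₂)
  where
  RS : Fin (size G) → Fin (size K) → Set
  RS a c = ∃ λ (b : Fin (size H)) → R a b × S b c
  isRS : IsBisimulation G K RS
  isRS a c (b , rab , sbc) = let l₁ , s₁ = isR a b rab ; l₂ , s₂ = isS b c sbc in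
    trans l₁ l₂ , Pointwise.trans (λ r s → _ , r , s) s₁ s₂

≃-node1 : ∀ (o : Op1) {G H : Graph} → G ≃ H → node1 o G ≃ node1 o H
≃-node1 o {G} {H} (R , isR , roots) = R′ , isR′ , tt
  where
  R′ : Fin (suc (size G)) → Fin (suc (size H)) → Set
  R′ zero    zero    = ⊤
  R′ (suc a) (suc b) = R a b
  R′ _       _       = ⊥
  isR′ : IsBisimulation (node1 o G) (node1 o H) R′
  isR′ zero    zero    _ = refl , succ1-pointwise o roots
  isR′ (suc a) (suc b) r = proj₁ (isR a b r) , Pointwise.map⁺ (λ r′ → r′) (proj₂ (isR a b r))

record Hom (H G : Graph) : Set where
  field
    vertex       : Fin (size H) → Fin (size G)
    vertex-label : ∀ a → label G (vertex a) ≡ label H a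
    vertex-succ  : ∀ a → Pointwise (λ x y → vertex x ≡ y) (succ H a) (succ G (vertex a))
open Hom public

id-hom : (G : Graph) → Hom G G
id-hom G = record
  { vertex = λ a → a ; vertex-label = λ _ → refl ; vertex-succ = λ a → Pointwise.refl refl }

homs⇒≃ : ∀ {G H₁ H₂ : Graph} (h₁ : Hom H₁ G) (h₂ : Hom H₂ G) →
         vertex h₁ (root H₁) ≡ vertex h₂ (root H₂) → H₁ ≃ H₂
homs⇒≃ {G} {H₁} {H₂} h₁ h₂ roots = R , isBisim , roots
  where
  R : Fin (size H₁) → Fin (size H₂) → Set
  R a b = vertex h₁ a ≡ vertex h₂ b
  isBisim : IsBisimulation H₁ H₂ R
  isBisim a b e =
    trans (sym (vertex-label h₁ a)) (trans (cong (label G) e) (vertex-label h₂ b)) ,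
    Pointwise.trans (λ e₁ e₂ → trans e₁ (sym e₂))
      (subst (λ v → Pointwise (λ x y → vertex h₁ x ≡ y) (succ H₁ a) (succ G v)) e (vertex-succ h₁ a))
      (Pointwise.sym (λ e′ → e′) (vertex-succ h₂ b))

node0-hom : ∀ {G : Graph} (o : Op0) (t : Fin (size G)) → label G t ≡ lab0 o → Hom (node0 o) G
node0-hom {G} o t l = record
  { vertex = λ _ → t ; vertex-label = λ _ → l ; vertex-succ = λ _ → succ0-nullary (succ G t) o l }

node1-hom : ∀ {H G : Graph} (o : Op1) (h : Hom H G) (t : Fin (size G)) → label G t ≡ lab1 o →
            Pointwise _≡_ (succ1 o (vertex h (root H))) (succ G t) → Hom (node1 o H) G
node1-hom {H} {G} o h t l p = record { vertex = f ; vertex-label = f-label ; vertex-succ = f-succ }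
  where
  f : Fin (suc (size H)) → Fin (size G)
  f zero    = t
  f (suc a) = vertex h a
  f-label : ∀ a → label G (f a) ≡ label (node1 o H) a
  f-label zero    = l
  f-label (suc a) = vertex-label h a
  f-succ : ∀ a → Pointwise (λ x y → f x ≡ y) (succ (node1 o H) a) (succ G (f a))
  f-succ zero    = Pointwise.trans trans (succ1-pointwise o refl) p
  f-succ (suc a) = Pointwise-mapˡ suc (vertex-succ h a)

node2-hom : ∀ {A B G : Graph} (o : Op2) (h₁ : Hom A G) (h₂ : Hom B G) (t : Fin (size G)) →
            label G t ≡ lab2 o →
            Pointwise _≡_ (succ2 o (vertex h₁ (root A)) (vertex h₂ (root B))) (succ G t) →
            Hom (node2 o A B) G
node2-hom {A} {B} {G} o h₁ h₂ t l p = record { vertex = f ; vertex-label = f-label ; vertex-succ = f-succ }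
  where
  n = size A
  m = size B
  f : Fin (suc (n + m)) → Fin (size G)
  f zero    = t
  f (suc k) = [ vertex h₁ , vertex h₂ ] (splitAt n k)
  f-↑ˡ : ∀ x → f (suc (x ↑ˡ m)) ≡ vertex h₁ x
  f-↑ˡ x rewrite splitAt-↑ˡ n x m = refl
  f-↑ʳ : ∀ x → f (suc (n ↑ʳ x)) ≡ vertex h₂ x
  f-↑ʳ x rewrite splitAt-↑ʳ n m x = refl
  f-label : ∀ a → label G (f a) ≡ label (node2 o A B) a
  f-label zero = l
  f-label (suc k) with splitAt n k
  ... | inj₁ a = vertex-label h₁ a
  ... | inj₂ b = vertex-label h₂ b
  f-succ : ∀ a → Pointwise (λ x y → f x ≡ y) (succ (node2 o A B) a) (succ G (f a))
  f-succ zero = Pointwise.trans trans (succ2-pointwise o (f-↑ˡ (root A)) (f-↑ʳ (root B))) p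
  f-succ (suc k) with splitAt n k
  ... | inj₁ a = Pointwise-mapˡ suc (Pointwise-mapˡ (_↑ˡ m) (Pointwise.map (trans (f-↑ˡ _)) (vertex-succ h₁ a)))
  ... | inj₂ b = Pointwise-mapˡ suc (Pointwise-mapˡ (n ↑ʳ_) (Pointwise.map (trans (f-↑ʳ _)) (vertex-succ h₂ b)))

node1-inj : ∀ {A : Graph} (o : Op1) → Hom A (node1 o A)
node1-inj {A} o = record
  { vertex = suc ; vertex-label = λ _ → refl
  ; vertex-succ = λ a → Pointwise-mapʳ suc (Pointwise.refl refl) }

node2-injˡ : ∀ {A B : Graph} (o : Op2) → Hom A (node2 o A B)
node2-injˡ {A} {B} o = record { vertex = λ a → suc (a ↑ˡ size B) ; vertex-label = f-label ; vertex-succ = f-succ }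
  where
  f-label : ∀ a → label (node2 o A B) (suc (a ↑ˡ size B)) ≡ label A a
  f-label a rewrite splitAt-↑ˡ (size A) a (size B) = refl
  f-succ : ∀ a → Pointwise (λ x y → suc (x ↑ˡ size B) ≡ y) (succ A a) (succ (node2 o A B) (suc (a ↑ˡ size B)))
  f-succ a with splitAt (size A) (a ↑ˡ size B) | splitAt-↑ˡ (size A) a (size B)
  ... | .(inj₁ a) | refl = Pointwise-mapʳ suc (Pointwise-mapʳ (_↑ˡ size B) (Pointwise.refl refl))

node2-injʳ : ∀ {A B : Graph} (o : Op2) → Hom B (node2 o A B)
node2-injʳ {A} {B} o = record { vertex = λ b → suc (size A ↑ʳ b) ; vertex-label = f-label ; vertex-succ = f-succ }
  where
  f-label : ∀ b → label (node2 o A B) (suc (size A ↑ʳ b)) ≡ label B b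
  f-label b rewrite splitAt-↑ʳ (size A) (size B) b = refl
  f-succ : ∀ b → Pointwise (λ x y → suc (size A ↑ʳ x) ≡ y) (succ B b) (succ (node2 o A B) (suc (size A ↑ʳ b)))
  f-succ b with splitAt (size A) (size A ↑ʳ b) | splitAt-↑ʳ (size A) (size B) b
  ... | .(inj₂ b) | refl = Pointwise-mapʳ suc (Pointwise-mapʳ (size A ↑ʳ_) (Pointwise.refl refl))

-- Guarded graphs

NonBoxEdge : (G : Graph) → Fin (size G) → Fin (size G) → Set
NonBoxEdge G b a = Edge G a b × label G a ≢ lbox

Rooted : Graph → Set
Rooted G = (v : Fin (size G)) → Reach G (root G) v

-- The inductive counterpart of "every cycle contains a □-occurrence"; unlike the
-- cycle condition it is evidently preserved by the connectives.
Guarded : Graph → Set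
Guarded G = Rooted G × WellFounded (NonBoxEdge G)

module _ {H G : Graph} (h : Hom H G) where

  hom-edge : ∀ {a b} → Edge H a b → Edge G (vertex h a) (vertex h b)
  hom-edge {a} e with Pointwise-∈ˡ (vertex-succ h a) e
  ... | _ , e′ , refl = e′

  hom-reach : ∀ {a b} → Reach H a b → Reach G (vertex h a) (vertex h b)
  hom-reach here       = here
  hom-reach (step e r) = step (hom-edge e) (hom-reach r)

  hom-acc : ∀ {a} → Acc (NonBoxEdge H) a → Acc (NonBoxEdge G) (vertex h a)
  hom-acc {a} (acc rs) = acc λ { (e , ¬□) → next e ¬□ }
    where
    next : ∀ {y} → Edge G (vertex h a) y → label G (vertex h a) ≢ lbox → Acc (NonBoxEdge G) y
    next e ¬□ with Pointwise-∈ʳ (vertex-succ h a) e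
    ... | x , x∈ , refl = hom-acc (rs (x∈ , ¬□ ∘ trans (vertex-label h a)))

  hom-acc⁻ : ∀ {x} → Acc (NonBoxEdge G) x → ∀ a → vertex h a ≡ x → Acc (NonBoxEdge H) a
  hom-acc⁻ (acc rs) a refl = acc λ { (e , ¬□) → next e ¬□ }
    where
    next : ∀ {b} → Edge H a b → label H a ≢ lbox → Acc (NonBoxEdge H) b
    next e ¬□ with Pointwise-∈ˡ (vertex-succ h a) e
    ... | y , y∈ , eq = hom-acc⁻ (rs (y∈ , ¬□ ∘ trans (sym (vertex-label h a)))) _ eq

guarded-node0 : (o : Op0) → Guarded (node0 o)
guarded-node0 o = (λ { zero → here }) , λ { zero → acc λ { (e , _) → ⊥-elim (∉-succ0 o e) } }

guarded-node1 : (o : Op1) {A : Graph} → Guarded A → Guarded (node1 o A)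
guarded-node1 o {A} (rootedA , wfA) = rooted′ , wf′
  where
  rooted′ : Rooted (node1 o A)
  rooted′ zero    = here
  rooted′ (suc a) = step (∈-succ1 o) (hom-reach (node1-inj o) (rootedA a))
  wf′ : WellFounded (NonBoxEdge (node1 o A))
  wf′ zero    = acc λ { (e , _) → subst (Acc _) (sym (∈-succ1⁻ o e)) (hom-acc (node1-inj o) (wfA (root A))) }
  wf′ (suc a) = hom-acc (node1-inj o) (wfA a)

guarded-node2 : (o : Op2) {A B : Graph} → Guarded A → Guarded B → Guarded (node2 o A B)
guarded-node2 o {A} {B} (rootedA , wfA) (rootedB , wfB) = rooted′ , wf′
  where
  n = size A
  m = size B
  K = node2 o A B
  rooted′ : Rooted K
  rooted′ zero = here
  rooted′ (suc k) with splitAt n k in eq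
  ... | inj₁ a = subst (Reach K zero ∘ suc) (splitAt⁻¹-↑ˡ eq)
                   (step (∈-succ2ˡ o) (hom-reach (node2-injˡ o) (rootedA a)))
  ... | inj₂ b = subst (Reach K zero ∘ suc) (splitAt⁻¹-↑ʳ eq)
                   (step (∈-succ2ʳ o) (hom-reach (node2-injʳ o) (rootedB b)))
  wf′ : WellFounded (NonBoxEdge K)
  wf′ (suc k) with splitAt n k in eq
  ... | inj₁ a = subst (Acc _ ∘ suc) (splitAt⁻¹-↑ˡ eq) (hom-acc (node2-injˡ o) (wfA a))
  ... | inj₂ b = subst (Acc _ ∘ suc) (splitAt⁻¹-↑ʳ eq) (hom-acc (node2-injʳ o) (wfB b))
  wf′ zero = acc λ { (e , _) → [ (λ { refl → hom-acc (node2-injˡ o) (wfA (root A)) })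
                               , (λ { refl → hom-acc (node2-injʳ o) (wfB (root B)) }) ] (∈-succ2⁻ o e) }

≟lbox : (l : Label) → Dec (l ≡ lbox)
≟lbox lbot     = no λ ()
≟lbox ltop     = no λ ()
≟lbox (lvar _) = no λ ()
≟lbox lneg     = no λ ()
≟lbox lbox     = yes refl
≟lbox land     = no λ ()
≟lbox lor      = no λ ()
≟lbox limp     = no λ ()

last-or-inject₁ : ∀ {k} (j : Fin (suc k)) → j ≡ fromℕ k ⊎ ∃ λ j′ → j ≡ inject₁ j′
last-or-inject₁ {zero}  zero    = inj₁ refl
last-or-inject₁ {suc k} zero    = inj₂ (zero , refl)
last-or-inject₁ {suc k} (suc j) with last-or-inject₁ j
... | inj₁ e        = inj₁ (cong suc e)
... | inj₂ (j′ , e) = inj₂ (suc j′ , cong suc e)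

cycle-next : {G : Graph} (c : Cycle G) (j : Fin (suc (len c))) → ∃ λ j′ → Edge G (vs c j) (vs c j′)
cycle-next c j with last-or-inject₁ j
... | inj₁ refl       = zero , close c
... | inj₂ (j′ , refl) = suc j′ , links c j′

cycle-has-□ : {G : Graph} → WellFounded (NonBoxEdge G) → (c : Cycle G) → ∃ λ j → label G (vs c j) ≡ lbox
cycle-has-□ {G} wf c with any? (λ j → ≟lbox (label G (vs c j)))
... | yes found = found
... | no none   = ⊥-elim (endless (wf (vs c zero)) zero refl)
  where
  endless : ∀ {x} → Acc (NonBoxEdge G) x → ∀ j → vs c j ≡ x → ⊥
  endless (acc rs) j refl with cycle-next c j
  ... | j′ , e = endless (rs (e , λ □ → none (j , □))) j′ refl

guarded⇒formula : {G : Graph} → Guarded G → IsFormula G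
guarded⇒formula (rooted , wf) = rooted , cycle-has-□ wf

InjectiveBelow : ∀ {n} → (ℕ → Fin n) → ℕ → Set
InjectiveBelow w k = ∀ a b → a < k → b < k → w a ≡ w b → a ≡ b

record FirstRepetition {n : ℕ} (w : ℕ → Fin n) : Set where
  field
    i j       : ℕ
    i<j       : i < j
    j≤n       : j ≤ n
    w-i≡w-j   : w i ≡ w j
    injective : InjectiveBelow w j

¬injective-below-suc : ∀ {n} (w : ℕ → Fin n) → ¬ InjectiveBelow w (suc n)
¬injective-below-suc {n} w inj with pigeonhole (n<1+n n) (w ∘ toℕ)
... | a , b , a<b , e = <-irrefl (cong toℕ (toℕ-injective (inj _ _ (toℕ<n a) (toℕ<n b) e))) a<b

first-repetition : ∀ {n} (w : ℕ → Fin n) → FirstRepetition w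
first-repetition {n} w = search (suc n) 0 (+-identityʳ (suc n)) (λ _ _ ())
  where
  search : ∀ m k → m + k ≡ suc n → InjectiveBelow w k → FirstRepetition w
  search zero    k refl inj = ⊥-elim (¬injective-below-suc w inj)
  search (suc m) k e    inj with anyUpTo? (λ a → w a ≟ w k) k
  ... | yes (a , a<k , eq) = record
    { i = a ; j = k ; i<j = a<k ; j≤n = ≤-pred (subst (suc k ≤_) e (s≤s (m≤n+m k m)))
    ; w-i≡w-j = eq ; injective = inj }
  ... | no fresh = search m (suc k) (trans (+-suc m k) e) inj′
    where
    inj′ : InjectiveBelow w (suc k)
    inj′ a b a<1+k b<1+k eq with m≤n⇒m<n∨m≡n (≤-pred a<1+k) | m≤n⇒m<n∨m≡n (≤-pred b<1+k)
    ... | inj₁ a<k  | inj₁ b<k  = inj a b a<k b<k eq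
    ... | inj₁ a<k  | inj₂ refl = ⊥-elim (fresh (a , a<k , eq))
    ... | inj₂ refl | inj₁ b<k  = ⊥-elim (fresh (b , b<k , sym eq))
    ... | inj₂ refl | inj₂ refl = refl

module _ {n : ℕ} {w : ℕ → Fin n} (r : FirstRepetition w) where
  open FirstRepetition r

  i+1+loop≡j : suc (i + (j ∸ suc i)) ≡ j
  i+1+loop≡j = m+[n∸m]≡n i<j

  loop-index<j : (t : Fin (suc (j ∸ suc i))) → i + toℕ t < j
  loop-index<j t = subst (i + toℕ t <_) i+1+loop≡j (s≤s (+-monoʳ-≤ i (≤-pred (toℕ<n t))))

repetition-cycle : {G : Graph} (w : ℕ → Fin (size G)) (r : FirstRepetition w) →
                   (∀ t → t < FirstRepetition.j r → Edge G (w t) (w (suc t))) → Cycle G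
repetition-cycle {G} w r edge = record
  { len = ℓ ; vs = vertexAt ; inj = injective-at ; links = link ; close = closing }
  where
  open FirstRepetition r
  ℓ = j ∸ suc i
  vertexAt : Fin (suc ℓ) → Fin (size G)
  vertexAt t = w (i + toℕ t)
  injective-at : ∀ {a b} → vertexAt a ≡ vertexAt b → a ≡ b
  injective-at {a} {b} e =
    toℕ-injective (+-cancelˡ-≡ i _ _ (injective _ _ (loop-index<j r a) (loop-index<j r b) e))
  link : (t : Fin ℓ) → Edge G (vertexAt (inject₁ t)) (vertexAt (suc t))
  link t = subst₂ (λ x y → Edge G (w x) (w y)) (cong (i +_) (sym (toℕ-inject₁ t))) (sym (+-suc i (toℕ t)))
             (edge (i + toℕ t) (subst (λ z → i + z < j) (toℕ-inject₁ t) (loop-index<j r (inject₁ t))))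
  closing : Edge G (vertexAt (fromℕ ℓ)) (vertexAt zero)
  closing = subst₂ (λ x y → Edge G (w x) y)
              (cong (i +_) (sym (toℕ-fromℕ ℓ)))
              (trans (cong w (i+1+loop≡j r)) (trans (sym w-i≡w-j) (cong w (sym (+-identityʳ i)))))
              (edge (i + ℓ) (subst (λ z → i + z < j) (toℕ-fromℕ ℓ) (loop-index<j r (fromℕ ℓ))))

NonBoxWalk : (G : Graph) → (ℕ → Fin (size G)) → ℕ → Set
NonBoxWalk G w k = ∀ t → t < k → NonBoxEdge G (w (suc t)) (w t)

module _ {G : Graph} (cycles : (c : Cycle G) → ∃ λ j → label G (vs c j) ≡ lbox) where

  ¬long-non-box-walk : ∀ w → ¬ NonBoxWalk G w (size G)
  ¬long-non-box-walk w walk = proj₂ (walk (i + toℕ t) (<-≤-trans (loop-index<j r t) j≤n)) □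
    where
    r = first-repetition w
    open FirstRepetition r
    boxed = cycles (repetition-cycle w r (λ t t<j → proj₁ (walk t (<-≤-trans t<j j≤n))))
    t = proj₁ boxed
    □ = proj₂ boxed

  no-long-walk⇒acc : ∀ k u → (∀ w → w 0 ≡ u → ¬ NonBoxWalk G w k) → Acc (NonBoxEdge G) u
  no-long-walk⇒acc zero    u short = ⊥-elim (short (λ _ → u) refl (λ _ ()))
  no-long-walk⇒acc (suc k) u short = acc λ {y} e → no-long-walk⇒acc k y λ w w0 walk →
    short (u ∷ʷ w) refl (extend w w0 e walk)
    where
    _∷ʷ_ : Fin (size G) → (ℕ → Fin (size G)) → ℕ → Fin (size G)
    (x ∷ʷ w) zero    = x
    (x ∷ʷ w) (suc t) = w t
    extend : ∀ {y} w → w 0 ≡ y → NonBoxEdge G y u → NonBoxWalk G w k → NonBoxWalk G (u ∷ʷ w) (suc k)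
    extend w refl e walk zero    _         = e
    extend w refl e walk (suc t) (s≤s t<k) = walk t t<k

formula⇒guarded : {G : Graph} → IsFormula G → Guarded G
formula⇒guarded {G} (rooted , cycles) =
  rooted , λ u → no-long-walk⇒acc cycles (size G) u (λ w _ → ¬long-non-box-walk cycles w)

-- Reachability

reach-snoc : ∀ {G : Graph} {a b c} → Reach G a b → Edge G b c → Reach G a c
reach-snoc here       e = step e here
reach-snoc (step e′ r) e = step e′ (reach-snoc r e)

module Paths (G : Graph) where
  private n = size G

  data Path : ℕ → Fin n → Fin n → Set where
    []  : ∀ {a} → Path 0 a a
    _∷_ : ∀ {k a c b} → Edge G a c → Path k c b → Path (suc k) a b

  data Within : ℕ → Fin n → Fin n → Set where
    here : ∀ {k a} → Within k a a
    step : ∀ {k a c b} → Edge G a c → Within k c b → Within (suc k) a b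

  _++ᵖ_ : ∀ {k l a c b} → Path k a c → Path l c b → Path (k + l) a b
  []      ++ᵖ q = q
  (e ∷ p) ++ᵖ q = e ∷ (p ++ᵖ q)

  reach⇒path : ∀ {a b} → Reach G a b → ∃ λ k → Path k a b
  reach⇒path here       = 0 , []
  reach⇒path (step e r) = suc (proj₁ (reach⇒path r)) , e ∷ proj₂ (reach⇒path r)

  within⇒reach : ∀ {k a b} → Within k a b → Reach G a b
  within⇒reach here       = here
  within⇒reach (step e r) = step e (within⇒reach r)

  path⇒within : ∀ {k m a b} → k ≤ m → Path k a b → Within m a b
  path⇒within _         []      = here
  path⇒within (s≤s k≤m) (e ∷ p) = step e (path⇒within k≤m p)

  walk : ∀ {k a b} → Path k a b → ℕ → Fin n
  walk {a = a} []      _       = a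
  walk {a = a} (e ∷ p) zero    = a
  walk         (e ∷ p) (suc t) = walk p t

  walk-start : ∀ {k a b} (p : Path k a b) → walk p 0 ≡ a
  walk-start []      = refl
  walk-start (e ∷ p) = refl

  walk-end : ∀ {k a b} (p : Path k a b) → walk p k ≡ b
  walk-end []      = refl
  walk-end (e ∷ p) = walk-end p

  walk-edge : ∀ {k a b} (p : Path k a b) → ∀ t → t < k → Edge G (walk p t) (walk p (suc t))
  walk-edge (e ∷ p) zero    _         = subst (Edge G _) (sym (walk-start p)) e
  walk-edge (e ∷ p) (suc t) (s≤s t<k) = walk-edge p t t<k

  segment : (w : ℕ → Fin n) (k : ℕ) → (∀ t → t < k → Edge G (w t) (w (suc t))) →
            ∀ d i → i + d ≤ k → Path d (w i) (w (i + d))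
  segment w k edge zero    i _ = subst (Path 0 (w i) ∘ w) (sym (+-identityʳ i)) []
  segment w k edge (suc d) i le =
    edge i (≤-<-trans (m≤m+n i d) le′) ∷
    subst (Path d (w (suc i)) ∘ w) (sym (+-suc i d)) (segment w k edge d (suc i) le′)
    where le′ = subst (_≤ k) (+-suc i d) le

  -- A path longer than the number of vertices repeats a vertex; cut out the loop.
  shorten : ∀ {k a b} → n < k → Path k a b → ∃ λ k′ → k′ < k × Path k′ a b
  shorten {k} n<k p = i + (k ∸ j) , shorter , subst₂ (Path (i + (k ∸ j))) (walk-start p) (walk-end p) cut
    where
    open FirstRepetition (first-repetition (walk p))
    j≤k : j ≤ k
    j≤k = ≤-trans j≤n (<⇒≤ n<k)
    before : Path i (walk p 0) (walk p i)
    before = segment (walk p) k (walk-edge p) i 0 (≤-trans (<⇒≤ i<j) j≤k)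
    after : Path (k ∸ j) (walk p j) (walk p (j + (k ∸ j)))
    after = segment (walk p) k (walk-edge p) (k ∸ j) j (≤-reflexive (m+[n∸m]≡n j≤k))
    cut : Path (i + (k ∸ j)) (walk p 0) (walk p k)
    cut = before ++ᵖ subst₂ (Path (k ∸ j)) (sym w-i≡w-j) (cong (walk p) (m+[n∸m]≡n j≤k)) after
    shorter : i + (k ∸ j) < k
    shorter = subst (i + (k ∸ j) <_) (m+[n∸m]≡n j≤k) (+-monoˡ-< (k ∸ j) i<j)

  path⇒within-size : ∀ k → Acc _<_ k → ∀ {a b} → Path k a b → Within n a b
  path⇒within-size k (acc rs) p with k ≤? n
  ... | yes k≤n = path⇒within k≤n p
  ... | no  k≰n = let k′ , k′<k , p′ = shorten (≰⇒> k≰n) p in path⇒within-size k′ (rs k′<k) p′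

  reach⇒within : ∀ {a b} → Reach G a b → Within n a b
  reach⇒within r = let k , p = reach⇒path r in path⇒within-size k (<-wellFounded k) p

  within? : ∀ k a b → Dec (Within k a b)
  within? k a b with a ≟ b
  ... | yes refl = yes here
  within? zero    a b | no a≢b = no λ { here → a≢b refl }
  within? (suc k) a b | no a≢b with Any.any? (λ c → within? k c b) (succ G a)
  ... | yes viaSucc = yes (let _ , c∈ , r = find viaSucc in step c∈ r)
  ... | no  noSucc  = no λ { here → a≢b refl ; (step e r) → noSucc (lose e r) }

  reach? : ∀ a b → Dec (Reach G a b)
  reach? a b with within? n a b
  ... | yes r = yes (within⇒reach r)
  ... | no ¬r = no (¬r ∘ reach⇒within)

-- Subformulas

record Enumeration (n : ℕ) (P : Fin n → Set) : Set where
  field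
    count         : ℕ
    element       : Fin count → Fin n
    element-P     : ∀ a → P (element a)
    index         : ∀ x → P x → Fin count
    element-index : ∀ x p → element (index x p) ≡ x
    index-element : ∀ a p → index (element a) p ≡ a

enumerate : ∀ n (P : Fin n → Set) → (∀ x → Dec (P x)) → Enumeration n P
enumerate zero    P P? = record
  { count = 0 ; element = λ () ; element-P = λ () ; index = λ ()
  ; element-index = λ () ; index-element = λ () }
enumerate (suc n) P P? with enumerate n (P ∘ suc) (P? ∘ suc) | P? zero
... | E | yes P0 = record
  { count = suc count ; element = element′ ; element-P = element-P′ ; index = index′
  ; element-index = element-index′ ; index-element = index-element′ }
  where
  open Enumeration E
  element′ : Fin (suc count) → Fin (suc n)
  element′ zero    = zero
  element′ (suc a) = suc (element a)
  element-P′ : ∀ a → P (element′ a)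
  element-P′ zero    = P0
  element-P′ (suc a) = element-P a
  index′ : ∀ x → P x → Fin (suc count)
  index′ zero    _ = zero
  index′ (suc x) p = suc (index x p)
  element-index′ : ∀ x p → element′ (index′ x p) ≡ x
  element-index′ zero    _ = refl
  element-index′ (suc x) p = cong suc (element-index x p)
  index-element′ : ∀ a p → index′ (element′ a) p ≡ a
  index-element′ zero    _ = refl
  index-element′ (suc a) p = cong suc (index-element a p)
... | E | no ¬P0 = record
  { count = count ; element = suc ∘ element ; element-P = element-P ; index = index′
  ; element-index = element-index′ ; index-element = index-element }
  where
  open Enumeration E
  index′ : ∀ x → P x → Fin count
  index′ zero    p = ⊥-elim (¬P0 p)
  index′ (suc x) p = index x p
  element-index′ : ∀ x p → suc (element (index′ x p)) ≡ x
  element-index′ zero    p = ⊥-elim (¬P0 p)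
  element-index′ (suc x) p = cong suc (element-index x p)

module Subgraph (G : Graph) (v : Fin (size G)) where
  open Paths G using (reach?)
  open Enumeration (enumerate (size G) (Reach G v) (reach? v))

  -- Vertices not reachable from v are sent to the root; they never occur.
  index? : Fin (size G) → Fin count
  index? x with reach? v x
  ... | yes r = index x r
  ... | no  _ = index v here

  element-index? : ∀ x → Reach G v x → element (index? x) ≡ x
  element-index? x r with reach? v x
  ... | yes r′ = element-index x r′
  ... | no ¬r  = ⊥-elim (¬r r)

  index?-element : ∀ a → index? (element a) ≡ a
  index?-element a with reach? v (element a)
  ... | yes r = index-element a r
  ... | no ¬r = ⊥-elim (¬r (element-P a))

  subgraph : Graph
  subgraph = record
    { size = count ; root = index? v
    ; label = label G ∘ element ; succ = λ a → map index? (succ G (element a)) }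

  subgraph-hom : Hom subgraph G
  subgraph-hom = record
    { vertex = element ; vertex-label = λ _ → refl
    ; vertex-succ = λ a → Pointwise-mapˡ index?
        (Pointwise-diagonal _ (λ y∈ → element-index? _ (reach-snoc (element-P a) y∈))) }

  subgraph-hom-root : element (index? v) ≡ v
  subgraph-hom-root = element-index? v here

  private
    lift : ∀ {x y} → Reach G x y → Reach G v x → Reach subgraph (index? x) (index? y)
    lift here _ = here
    lift {x} (step {w = z} e r) v↝x =
      step (subst (λ t → index? z ∈ map index? (succ G t)) (sym (element-index? x v↝x)) (∈-map⁺ index? e))
           (lift r (reach-snoc v↝x e))

  subgraph-guarded : WellFounded (NonBoxEdge G) → Guarded subgraph
  subgraph-guarded wf = (λ a → subst (Reach subgraph (index? v)) (index?-element a) (lift (element-P a) here))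
                      , (λ a → hom-acc⁻ subgraph-hom (wf (element a)) a refl)

open Subgraph using (subgraph; subgraph-hom; subgraph-hom-root; subgraph-guarded)

module _ (K : Graph) where

  subgraph-root-≃ : subgraph K (root K) ≃ K
  subgraph-root-≃ = homs⇒≃ (subgraph-hom K (root K)) (id-hom K) (subgraph-hom-root K (root K))

  subgraph-nullary-≃ : ∀ x (o : Op0) → label K x ≡ lab0 o → subgraph K x ≃ node0 o
  subgraph-nullary-≃ x o l = homs⇒≃ (subgraph-hom K x) (node0-hom o x l) (subgraph-hom-root K x)

  subgraph-unary-≃ : ∀ x (o : Op1) y → label K x ≡ lab1 o → Pointwise _≡_ (succ1 o y) (succ K x) →
                     subgraph K x ≃ node1 o (subgraph K y)
  subgraph-unary-≃ x o y l p = homs⇒≃ (subgraph-hom K x)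
    (node1-hom o (subgraph-hom K y) x l
      (Pointwise.trans trans (succ1-pointwise o (subgraph-hom-root K y)) p))
    (subgraph-hom-root K x)

  subgraph-binary-≃ : ∀ x (o : Op2) y₁ y₂ → label K x ≡ lab2 o →
                      Pointwise _≡_ (succ2 o y₁ y₂) (succ K x) →
                      subgraph K x ≃ node2 o (subgraph K y₁) (subgraph K y₂)
  subgraph-binary-≃ x o y₁ y₂ l p = homs⇒≃ (subgraph-hom K x)
    (node2-hom o (subgraph-hom K y₁) (subgraph-hom K y₂) x l
      (Pointwise.trans trans (succ2-pointwise o (subgraph-hom-root K y₁) (subgraph-hom-root K y₂)) p))
    (subgraph-hom-root K x)

-- Derivations

-- Formulas carry their guardedness, which discharges the IsFormula side condition of
-- every rule.
record Formula : Set where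
  constructor formula
  field
    graph   : Graph
    guarded : Guarded graph
open Formula public

isFormula : (A : Formula) → IsFormula (graph A)
isFormula A = guarded⇒formula (guarded A)

node0ᶠ : Op0 → Formula
node0ᶠ o = formula (node0 o) (guarded-node0 o)

node1ᶠ : Op1 → Formula → Formula
node1ᶠ o A = formula (node1 o (graph A)) (guarded-node1 o (guarded A))

node2ᶠ : Op2 → Formula → Formula → Formula
node2ᶠ o A B = formula (node2 o (graph A) (graph B)) (guarded-node2 o (guarded A) (guarded B))

⊤ᶠ : Formula
⊤ᶠ = node0ᶠ otop

□ᶠ_ : Formula → Formula
□ᶠ_ = node1ᶠ obox

_∧ᶠ_ _⇒ᶠ_ _⇔ᶠ_ : Formula → Formula → Formula
_∧ᶠ_ = node2ᶠ oand
_⇒ᶠ_ = node2ᶠ oimp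
A ⇔ᶠ B = (A ⇒ᶠ B) ∧ᶠ (B ⇒ᶠ A)

infix  7 □ᶠ_
infixr 6 _∧ᶠ_
infixr 5 _⇒ᶠ_
infix  4 _⇔ᶠ_

record ⊢_ (A : Formula) : Set₁ where
  constructor proof
  field derivation : GL°⊢ graph A
open ⊢_ public

infix 2 ⊢_

variable
  A B C H : Formula

modus-ponens : ⊢ A → ⊢ A ⇒ᶠ B → ⊢ B
modus-ponens {B = B} (proof p) (proof q) = proof (mp p q (isFormula B))

necessitation : ⊢ A → ⊢ □ᶠ A
necessitation {A} (proof p) = proof (nec p (isFormula (□ᶠ A)))

löb-rule : ⊢ □ᶠ A ⇒ᶠ A → ⊢ A
löb-rule {A} (proof p) = proof (löb p (isFormula A))

axiom-K : ∀ A B → ⊢ □ᶠ (A ⇒ᶠ B) ⇒ᶠ □ᶠ A ⇒ᶠ □ᶠ B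
axiom-K A B = proof (kax (graph A) (graph B) (isFormula (□ᶠ (A ⇒ᶠ B) ⇒ᶠ □ᶠ A ⇒ᶠ □ᶠ B)))

axiom-4 : ∀ A → ⊢ □ᶠ A ⇒ᶠ □ᶠ □ᶠ A
axiom-4 A = proof (extra _ (four (graph A)) (isFormula (□ᶠ A ⇒ᶠ □ᶠ □ᶠ A)))

bisimilar : ∀ A B → graph A ≃ graph B → ⊢ A ⇔ᶠ B
bisimilar A B A≃B = proof (bisim (graph A) (graph B) A≃B (isFormula (A ⇔ᶠ B)))

_‼_ : List Formula → ℕ → Formula
[]      ‼ _     = ⊤ᶠ
(A ∷ σ) ‼ zero  = A
(A ∷ σ) ‼ suc i = σ ‼ i

substitute : List Formula → PForm → Formula
substitute σ (pvar i)   = σ ‼ i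
substitute σ pbot       = node0ᶠ obot
substitute σ ptop       = ⊤ᶠ
substitute σ (pneg P)   = node1ᶠ oneg (substitute σ P)
substitute σ (pand P Q) = node2ᶠ oand (substitute σ P) (substitute σ Q)
substitute σ (por P Q)  = node2ᶠ oor (substitute σ P) (substitute σ Q)
substitute σ (pimp P Q) = node2ᶠ oimp (substitute σ P) (substitute σ Q)

graph-substitute : ∀ σ P → graph (substitute σ P) ≡ inst (graph ∘ (σ ‼_)) P
graph-substitute σ (pvar i)   = refl
graph-substitute σ pbot       = refl
graph-substitute σ ptop       = refl
graph-substitute σ (pneg P)   = cong (node1 oneg) (graph-substitute σ P)
graph-substitute σ (pand P Q) = cong₂ (node2 oand) (graph-substitute σ P) (graph-substitute σ Q)
graph-substitute σ (por P Q)  = cong₂ (node2 oor) (graph-substitute σ P) (graph-substitute σ Q)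
graph-substitute σ (pimp P Q) = cong₂ (node2 oimp) (graph-substitute σ P) (graph-substitute σ Q)

tautology : (P : PForm) → Tautology P → (σ : List Formula) → ⊢ substitute σ P
tautology P taut-P σ = proof (subst GL°⊢_ (sym eq)
  (taut P taut-P (graph ∘ (σ ‼_)) (subst IsFormula eq (isFormula (substitute σ P)))))
  where eq = graph-substitute σ P

_∷ᵛ_ : Bool → (ℕ → Bool) → ℕ → Bool
(b ∷ᵛ v) zero    = b
(b ∷ᵛ v) (suc i) = v i

truncate : ℕ → (ℕ → Bool) → ℕ → Bool
truncate zero    v = λ _ → false
truncate (suc k) v = v 0 ∷ᵛ truncate k (v ∘ suc)

allValuations : ℕ → ((ℕ → Bool) → Bool) → Bool
allValuations zero    f = f (λ _ → false)
allValuations (suc k) f = allValuations k (f ∘ (true ∷ᵛ_)) ∧ allValuations k (f ∘ (false ∷ᵛ_))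

allValuations-sound : ∀ k f → T (allValuations k f) → ∀ v → T (f (truncate k v))
allValuations-sound zero    f h v = h
allValuations-sound (suc k) f h v with v 0 | Equivalence.to T-∧ h
... | true  | h₁ , _ = allValuations-sound k (f ∘ (true ∷ᵛ_)) h₁ (v ∘ suc)
... | false | _ , h₂ = allValuations-sound k (f ∘ (false ∷ᵛ_)) h₂ (v ∘ suc)

-- For P in the variables 0, …, 4, `eval (truncate 5 v) P` computes to `eval v P`,
-- so the result is accepted as a proof of `Tautology P`.
byTruthTable : ∀ P → T (allValuations 5 (λ v → eval v P)) → ∀ v → eval (truncate 5 v) P ≡ true
byTruthTable P h v = Equivalence.to T-≡ (allValuations-sound 5 (λ v → eval v P) h v)

private
  x₀ x₁ x₂ x₃ x₄ : PForm
  x₀ = pvar 0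
  x₁ = pvar 1
  x₂ = pvar 2
  x₃ = pvar 3
  x₄ = pvar 4

  _⟹_ _⟺_ : PForm → PForm → PForm
  _⟹_ = pimp
  P ⟺ Q = pand (P ⟹ Q) (Q ⟹ P)

  infixr 5 _⟹_
  infix  6 _⟺_

⇒-refl : ⊢ A ⇒ᶠ A
⇒-refl {A} = tautology (x₀ ⟹ x₀) (byTruthTable (x₀ ⟹ x₀) _) (A ∷ [])

⇒-trans : ⊢ A ⇒ᶠ B → ⊢ B ⇒ᶠ C → ⊢ A ⇒ᶠ C
⇒-trans {A} {B} {C} p q = modus-ponens q (modus-ponens p (tautology P (byTruthTable P _) (A ∷ B ∷ C ∷ [])))
  where P = (x₀ ⟹ x₁) ⟹ (x₁ ⟹ x₂) ⟹ x₀ ⟹ x₂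

⇒-app : ⊢ H ⇒ᶠ A ⇒ᶠ B → ⊢ H ⇒ᶠ A → ⊢ H ⇒ᶠ B
⇒-app {H} {A} {B} p q = modus-ponens q (modus-ponens p (tautology P (byTruthTable P _) (H ∷ A ∷ B ∷ [])))
  where P = (x₀ ⟹ x₁ ⟹ x₂) ⟹ (x₀ ⟹ x₁) ⟹ x₀ ⟹ x₂

⇒-const : ⊢ A → ⊢ H ⇒ᶠ A
⇒-const {A} {H} p = modus-ponens p (tautology P (byTruthTable P _) (A ∷ H ∷ []))
  where P = x₀ ⟹ x₁ ⟹ x₀

⇒-⊤ : ⊢ H ⇒ᶠ ⊤ᶠ
⇒-⊤ {H} = tautology (x₀ ⟹ ptop) (byTruthTable (x₀ ⟹ ptop) _) (H ∷ [])

∧-fst : ⊢ A ∧ᶠ B ⇒ᶠ A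
∧-fst {A} {B} = tautology P (byTruthTable P _) (A ∷ B ∷ [])
  where P = pand x₀ x₁ ⟹ x₀

∧-snd : ⊢ A ∧ᶠ B ⇒ᶠ B
∧-snd {A} {B} = tautology P (byTruthTable P _) (A ∷ B ∷ [])
  where P = pand x₀ x₁ ⟹ x₁

∧-intro : ⊢ A → ⊢ B → ⊢ A ∧ᶠ B
∧-intro {A} {B} p q = modus-ponens q (modus-ponens p (tautology P (byTruthTable P _) (A ∷ B ∷ [])))
  where P = x₀ ⟹ x₁ ⟹ pand x₀ x₁

⇒-∧ : ⊢ H ⇒ᶠ A → ⊢ H ⇒ᶠ B → ⊢ H ⇒ᶠ A ∧ᶠ B
⇒-∧ {H} {A} {B} p q = modus-ponens q (modus-ponens p (tautology P (byTruthTable P _) (H ∷ A ∷ B ∷ [])))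
  where P = (x₀ ⟹ x₁) ⟹ (x₀ ⟹ x₂) ⟹ x₀ ⟹ pand x₁ x₂

⇒-curry : ⊢ A ∧ᶠ B ⇒ᶠ C → ⊢ A ⇒ᶠ B ⇒ᶠ C
⇒-curry {A} {B} {C} p = modus-ponens p (tautology P (byTruthTable P _) (A ∷ B ∷ C ∷ []))
  where P = (pand x₀ x₁ ⟹ x₂) ⟹ x₀ ⟹ x₁ ⟹ x₂

⇔-refl : ⊢ A ⇔ᶠ A
⇔-refl = ∧-intro ⇒-refl ⇒-refl

⇔-to : ⊢ A ⇔ᶠ B → ⊢ A ⇒ᶠ B
⇔-to p = modus-ponens p ∧-fst

⇔-from : ⊢ A ⇔ᶠ B → ⊢ B ⇒ᶠ A
⇔-from p = modus-ponens p ∧-snd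

⇒-⇔-⊤ : ⊢ H ⇒ᶠ A → ⊢ H ⇒ᶠ (A ⇔ᶠ ⊤ᶠ)
⇒-⇔-⊤ {H} {A} p = modus-ponens p (tautology P (byTruthTable P _) (H ∷ A ∷ []))
  where P = (x₀ ⟹ x₁) ⟹ x₀ ⟹ (x₁ ⟺ ptop)

⇒-⇔-transport : ∀ {A A′ B B′} → ⊢ A ⇔ᶠ A′ → ⊢ B ⇔ᶠ B′ → ⊢ H ⇒ᶠ (A′ ⇔ᶠ B′) → ⊢ H ⇒ᶠ (A ⇔ᶠ B)
⇒-⇔-transport {H} {A} {A′} {B} {B′} p q r =
  modus-ponens r (modus-ponens q (modus-ponens p (tautology P (byTruthTable P _) (A ∷ A′ ∷ B ∷ B′ ∷ H ∷ []))))
  where P = (x₀ ⟺ x₁) ⟹ (x₂ ⟺ x₃) ⟹ (x₄ ⟹ (x₁ ⟺ x₃)) ⟹ x₄ ⟹ (x₀ ⟺ x₂)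

⇒-⇔-cong-¬ : ⊢ H ⇒ᶠ (A ⇔ᶠ B) → ⊢ H ⇒ᶠ (node1ᶠ oneg A ⇔ᶠ node1ᶠ oneg B)
⇒-⇔-cong-¬ {H} {A} {B} p = modus-ponens p (tautology P (byTruthTable P _) (H ∷ A ∷ B ∷ []))
  where P = (x₀ ⟹ (x₁ ⟺ x₂)) ⟹ x₀ ⟹ (pneg x₁ ⟺ pneg x₂)

⇒-⇔-cong₂ : ∀ (o : Op2) {A B C D} → ⊢ H ⇒ᶠ (A ⇔ᶠ B) → ⊢ H ⇒ᶠ (C ⇔ᶠ D) →
            ⊢ H ⇒ᶠ (node2ᶠ o A C ⇔ᶠ node2ᶠ o B D)
⇒-⇔-cong₂ {H} o {A} {B} {C} {D} p q = modus-ponens q (modus-ponens p (congruence o))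
  where
  σ = H ∷ A ∷ B ∷ C ∷ D ∷ []
  P : (PForm → PForm → PForm) → PForm
  P _∙_ = (x₀ ⟹ (x₁ ⟺ x₂)) ⟹ (x₀ ⟹ (x₃ ⟺ x₄)) ⟹ x₀ ⟹ (x₁ ∙ x₃ ⟺ x₂ ∙ x₄)
  congruence : ∀ o → ⊢ (H ⇒ᶠ (A ⇔ᶠ B)) ⇒ᶠ (H ⇒ᶠ (C ⇔ᶠ D)) ⇒ᶠ H ⇒ᶠ (node2ᶠ o A C ⇔ᶠ node2ᶠ o B D)
  congruence oand = tautology (P pand) (byTruthTable (P pand) _) σ
  congruence oor  = tautology (P por)  (byTruthTable (P por) _)  σ
  congruence oimp = tautology (P pimp) (byTruthTable (P pimp) _) σ

□-mono : ⊢ A ⇒ᶠ B → ⊢ □ᶠ A ⇒ᶠ □ᶠ B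
□-mono {A} {B} p = modus-ponens (necessitation p) (axiom-K A B)

□-⇔ : ⊢ □ᶠ (A ⇔ᶠ B) ⇒ᶠ (□ᶠ A ⇔ᶠ □ᶠ B)
□-⇔ {A} {B} = ⇒-∧ (⇒-trans (□-mono ∧-fst) (axiom-K A B)) (⇒-trans (□-mono ∧-snd) (axiom-K B A))

⇒□-if-≃□ : ∀ B → graph A ≃ graph (□ᶠ B) → ⊢ A ⇒ᶠ □ᶠ A
⇒□-if-≃□ {A} B A≃□B =
  ⇒-trans (⇔-to (bisimilar A (□ᶠ B) A≃□B))
    (⇒-trans (axiom-4 B) (⇔-from (bisimilar (□ᶠ A) (□ᶠ □ᶠ B) (≃-node1 obox A≃□B))))

⋀ : ∀ {n} → (Fin n → Formula) → Formula
⋀ {zero}  f = ⊤ᶠ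
⋀ {suc n} f = f zero ∧ᶠ ⋀ (f ∘ suc)

⋀-elim : ∀ {n} (f : Fin n → Formula) i → ⊢ ⋀ f ⇒ᶠ f i
⋀-elim f zero    = ∧-fst
⋀-elim f (suc i) = ⇒-trans ∧-snd (⋀-elim (f ∘ suc) i)

⋀-intro : ∀ {n} (f : Fin n → Formula) → (∀ i → ⊢ H ⇒ᶠ f i) → ⊢ H ⇒ᶠ ⋀ f
⋀-intro {n = zero}  f p = ⇒-⊤
⋀-intro {n = suc n} f p = ⇒-∧ (p zero) (⋀-intro (f ∘ suc) (p ∘ suc))

-- Redirecting the edges into the root

module Redirect (o : Op0) (G : Graph) where
  private
    n = size G
    r = root G
    X = redirect o G

  corresponding : Fin n → Fin (suc n)
  corresponding w with w ≟ r
  ... | yes _ = zero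
  ... | no  _ = suc w

  corresponding-root : ∀ {w} → w ≡ r → corresponding w ≡ zero
  corresponding-root {w} w≡r with w ≟ r
  ... | yes _   = refl
  ... | no  w≢r = ⊥-elim (w≢r w≡r)

  corresponding-other : ∀ {w} → w ≢ r → corresponding w ≡ suc w
  corresponding-other {w} w≢r with w ≟ r
  ... | yes w≡r = ⊥-elim (w≢r w≡r)
  ... | no  _   = refl

  -- `redirect` renames successors by a local function, which agrees with `corresponding`
  -- only once the comparison with the root is decided for each successor.
  redirect-succ : ∀ v → Pointwise (λ a b → corresponding a ≡ b) (succ G v) (succ X (suc v))
  redirect-succ v with label G v | succ G v
  ... | lbot   | [] = []
  ... | ltop   | [] = []
  ... | lvar _ | [] = []
  ... | lneg | x ∷ [] with x ≟ r
  ...   | yes x≡r = corresponding-root x≡r ∷ []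
  ...   | no  x≢r = corresponding-other x≢r ∷ []
  redirect-succ v | lbox | x ∷ [] with x ≟ r
  ...   | yes x≡r = corresponding-root x≡r ∷ []
  ...   | no  x≢r = corresponding-other x≢r ∷ []
  redirect-succ v | land | x ∷ y ∷ [] with x ≟ r | y ≟ r
  ...   | yes x≡r | yes y≡r = corresponding-root x≡r ∷ corresponding-root y≡r ∷ []
  ...   | yes x≡r | no  y≢r = corresponding-root x≡r ∷ corresponding-other y≢r ∷ []
  ...   | no  x≢r | yes y≡r = corresponding-other x≢r ∷ corresponding-root y≡r ∷ []
  ...   | no  x≢r | no  y≢r = corresponding-other x≢r ∷ corresponding-other y≢r ∷ []
  redirect-succ v | lor  | x ∷ y ∷ [] with x ≟ r | y ≟ r
  ...   | yes x≡r | yes y≡r = corresponding-root x≡r ∷ corresponding-root y≡r ∷ []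
  ...   | yes x≡r | no  y≢r = corresponding-root x≡r ∷ corresponding-other y≢r ∷ []
  ...   | no  x≢r | yes y≡r = corresponding-other x≢r ∷ corresponding-root y≡r ∷ []
  ...   | no  x≢r | no  y≢r = corresponding-other x≢r ∷ corresponding-other y≢r ∷ []
  redirect-succ v | limp | x ∷ y ∷ [] with x ≟ r | y ≟ r
  ...   | yes x≡r | yes y≡r = corresponding-root x≡r ∷ corresponding-root y≡r ∷ []
  ...   | yes x≡r | no  y≢r = corresponding-root x≡r ∷ corresponding-other y≢r ∷ []
  ...   | no  x≢r | yes y≡r = corresponding-other x≢r ∷ corresponding-root y≡r ∷ []
  ...   | no  x≢r | no  y≢r = corresponding-other x≢r ∷ corresponding-other y≢r ∷ []

  redirect-edge : ∀ {a w} → Edge G a w → Edge X (suc a) (corresponding w)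
  redirect-edge {a} e with Pointwise-∈ˡ (redirect-succ a) e
  ... | _ , e′ , refl = e′

  -- A path of G lifts to X from its last visit to the root on.
  lift : ∀ {a v} → Reach G a v → v ≢ r → Reach X (suc a) (suc v) ⊎ Reach X (suc r) (suc v)
  lift here _ = inj₁ here
  lift (step {u = a} {w = w} e rest) v≢r with lift rest v≢r | w ≟ r
  ... | inj₂ from-root | _        = inj₂ from-root
  ... | inj₁ from-w    | yes refl = inj₂ from-w
  ... | inj₁ from-w    | no  w≢r  =
    inj₁ (step (subst (Edge X (suc a)) (corresponding-other w≢r) (redirect-edge e)) from-w)

  reach-from-root : Rooted G → ∀ v → Reach X (suc r) (suc v)
  reach-from-root rooted v with v ≟ r
  ... | yes refl = here
  ... | no  v≢r  = reduce (lift (rooted v) v≢r)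

  root-predecessor : RootOnCycle G → ∃ λ x → Edge G x r
  root-predecessor (c , zero  , e) = _ , subst (Edge G _) e (close c)
  root-predecessor (c , suc j , e) = _ , subst (Edge G _) e (links c j)

  redirect-rooted : Rooted G → RootOnCycle G → Rooted X
  redirect-rooted rooted cyclic zero    = let x , e = root-predecessor cyclic in
    reach-snoc (reach-from-root rooted x) (subst (Edge X (suc x)) (corresponding-root refl) (redirect-edge e))
  redirect-rooted rooted cyclic (suc v) = reach-from-root rooted v

  redirect-wf : WellFounded (NonBoxEdge G) → WellFounded (NonBoxEdge X)
  redirect-wf wf zero    = acc λ { (e , _) → ⊥-elim (∉-succ0 o e) }
  redirect-wf wf (suc v) = lifted (wf v)
    where
    lifted : ∀ {v} → Acc (NonBoxEdge G) v → Acc (NonBoxEdge X) (suc v)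
    lifted {v} (acc rs) = acc λ { (e , ¬□) → next e ¬□ }
      where
      next : ∀ {y} → Edge X (suc v) y → label G v ≢ lbox → Acc (NonBoxEdge X) y
      next e ¬□ with Pointwise-∈ʳ (redirect-succ v) e
      ... | w , w∈ , refl with w ≟ r
      ...   | yes _ = redirect-wf wf zero
      ...   | no  _ = lifted (rs (w∈ , ¬□))

  redirect-guarded : Guarded G → RootOnCycle G → Guarded X
  redirect-guarded (rooted , wf) cyclic = redirect-rooted rooted cyclic , redirect-wf wf

sub : (K : Formula) → Fin (size (graph K)) → Formula
sub K x = formula (subgraph (graph K) x) (subgraph-guarded (graph K) x (proj₂ (guarded K)))

module _ (K : Formula) where
  private G = graph K

  sub-root : ⊢ sub K (root G) ⇔ᶠ K
  sub-root = bisimilar (sub K (root G)) K (subgraph-root-≃ G)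

  sub-nullary : ∀ x (o : Op0) → label G x ≡ lab0 o → ⊢ sub K x ⇔ᶠ node0ᶠ o
  sub-nullary x o l = bisimilar (sub K x) (node0ᶠ o) (subgraph-nullary-≃ G x o l)

  sub-unary : ∀ x (o : Op1) y → label G x ≡ lab1 o → Pointwise _≡_ (succ1 o y) (succ G x) →
              ⊢ sub K x ⇔ᶠ node1ᶠ o (sub K y)
  sub-unary x o y l p = bisimilar (sub K x) (node1ᶠ o (sub K y)) (subgraph-unary-≃ G x o y l p)

  sub-binary : ∀ x (o : Op2) y₁ y₂ → label G x ≡ lab2 o → Pointwise _≡_ (succ2 o y₁ y₂) (succ G x) →
               ⊢ sub K x ⇔ᶠ node2ᶠ o (sub K y₁) (sub K y₂)
  sub-binary x o y₁ y₂ l p =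
    bisimilar (sub K x) (node2ᶠ o (sub K y₁) (sub K y₂)) (subgraph-binary-≃ G x o y₁ y₂ l p)

  □-rooted-≃ : ∀ y → label G (root G) ≡ lbox → Pointwise _≡_ (succ1 obox y) (succ G (root G)) →
               G ≃ graph (□ᶠ sub K y)
  □-rooted-≃ y l p = ≃-trans (≃-sym (subgraph-root-≃ G)) (subgraph-unary-≃ G (root G) obox y l p)

□-successor : ∀ {n} {l} (xs : Vec (Fin n) (arity l)) → l ≡ lbox → ∃ λ y → Pointwise _≡_ (succ1 obox y) xs
□-successor (y ∷ []) refl = y , refl ∷ []

module Agreement (ψ : Formula) (root-□ : label (graph ψ) (root (graph ψ)) ≡ lbox)
                 (cyclic : RootOnCycle (graph ψ)) where
  private
    G = graph ψ
    n = size G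
    r = root G
    X = redirect otop G
  open Redirect otop G

  χ : Formula
  χ = formula X (redirect-guarded (guarded ψ) cyclic)

  Ψ : Fin n → Formula
  Ψ = sub ψ

  Χ : Fin (suc n) → Formula
  Χ = sub χ

  agree : Fin n → Formula
  agree u = Ψ u ⇔ᶠ Χ (corresponding u)

  claim : Formula
  claim = ψ ⇒ᶠ ⋀ agree

  hyp : Formula
  hyp = □ᶠ claim ∧ᶠ ψ

  X-successors : ∀ u {m} {xs : Vec (Fin n) m} → Pointwise _≡_ xs (succ G u) →
                 Pointwise _≡_ (map corresponding xs) (succ X (suc u))
  X-successors u p = Pointwise-mapˡ corresponding
    (Pointwise.trans (λ e₁ e₂ → trans (cong corresponding e₁) e₂) p (redirect-succ u))

  X-unary : ∀ {u} (o : Op1) {w} → Pointwise _≡_ (succ1 o w) (succ G u) →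
            Pointwise _≡_ (succ1 o (corresponding w)) (succ X (suc u))
  X-unary {u} o p =
    Pointwise.trans trans (Pointwise-mapʳ corresponding (succ1-pointwise o refl)) (X-successors u p)

  X-binary : ∀ {u} (o : Op2) {w₁ w₂} → Pointwise _≡_ (succ2 o w₁ w₂) (succ G u) →
             Pointwise _≡_ (succ2 o (corresponding w₁) (corresponding w₂)) (succ X (suc u))
  X-binary {u} o p =
    Pointwise.trans trans (Pointwise-mapʳ corresponding (succ2-pointwise o refl refl)) (X-successors u p)

  s : Fin n
  s = proj₁ (□-successor (succ G r) root-□)

  ψ≃□Ψs : G ≃ graph (□ᶠ Ψ s)
  ψ≃□Ψs = □-rooted-≃ ψ s root-□ (proj₂ (□-successor (succ G r) root-□))

  χ≃□Χs : X ≃ graph (□ᶠ Χ (corresponding s))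
  χ≃□Χs = □-rooted-≃ χ (corresponding s) root-□ (X-unary obox (proj₂ (□-successor (succ G r) root-□)))

  hyp⇒□agree : ∀ w → ⊢ hyp ⇒ᶠ □ᶠ agree w
  hyp⇒□agree w = ⇒-trans (⇒-app (⇒-trans ∧-fst (axiom-K ψ (⋀ agree))) (⇒-trans ∧-snd (⇒□-if-≃□ (Ψ s) ψ≃□Ψs)))
                         (□-mono (⋀-elim agree w))

  agree-root : ⊢ hyp ⇒ᶠ (Ψ r ⇔ᶠ Χ zero)
  agree-root = ⇒-⇔-transport (sub-root ψ) (sub-nullary χ zero otop refl) (⇒-⇔-⊤ ∧-snd)

  agree-other : ∀ u → (∀ {w} → NonBoxEdge G w u → ⊢ hyp ⇒ᶠ agree w) →
                Shape (label G u) (succ G u) → ⊢ hyp ⇒ᶠ (Ψ u ⇔ᶠ Χ (suc u))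
  agree-other u ih (nullary o l) =
    ⇒-⇔-transport (sub-nullary ψ u o l) (sub-nullary χ (suc u) o l) (⇒-const ⇔-refl)
  agree-other u ih (unary oneg w l p) =
    ⇒-⇔-transport (sub-unary ψ u oneg w l p) (sub-unary χ (suc u) oneg (corresponding w) l (X-unary oneg p))
      (⇒-⇔-cong-¬ (ih (Pointwise-≡-∈ p (∈-succ1 oneg) , λ □ → contradiction (trans (sym l) □) λ ())))
  agree-other u ih (unary obox w l p) =
    ⇒-⇔-transport (sub-unary ψ u obox w l p) (sub-unary χ (suc u) obox (corresponding w) l (X-unary obox p))
      (⇒-trans (hyp⇒□agree w) □-⇔)
  agree-other u ih (binary o w₁ w₂ l p) =
    ⇒-⇔-transport (sub-binary ψ u o w₁ w₂ l p)
      (sub-binary χ (suc u) o (corresponding w₁) (corresponding w₂) l (X-binary o p))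
      (⇒-⇔-cong₂ o (ih (Pointwise-≡-∈ p (∈-succ2ˡ o) , lab2≢lbox o ∘ trans (sym l)))
                   (ih (Pointwise-≡-∈ p (∈-succ2ʳ o) , lab2≢lbox o ∘ trans (sym l))))

  agree-at : ∀ {u x} → corresponding u ≡ x → ⊢ hyp ⇒ᶠ (Ψ u ⇔ᶠ Χ x) → ⊢ hyp ⇒ᶠ agree u
  agree-at refl p = p

  agree-step : ∀ u → Dec (u ≡ r) → (∀ {w} → NonBoxEdge G w u → ⊢ hyp ⇒ᶠ agree w) → ⊢ hyp ⇒ᶠ agree u
  agree-step _ (yes refl) _  = agree-at (corresponding-root refl) agree-root
  agree-step u (no u≢r)   ih = agree-at (corresponding-other u≢r) (agree-other u ih (shape G u))

  hyp⇒agree : ∀ u → Acc (NonBoxEdge G) u → ⊢ hyp ⇒ᶠ agree u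
  hyp⇒agree u (acc rs) = agree-step u (u ≟ r) (λ e → hyp⇒agree _ (rs e))

  ⊢claim : ⊢ claim
  ⊢claim = löb-rule (⇒-curry (⋀-intro agree (λ u → hyp⇒agree u (proj₂ (guarded ψ) u))))

  □ψ⇒ψ⇔χ : ⊢ □ᶠ ψ ⇒ᶠ (ψ ⇔ᶠ χ)
  □ψ⇒ψ⇔χ = ⇒-⇔-transport (bisimilar ψ (□ᶠ Ψ s) ψ≃□Ψs) (bisimilar χ (□ᶠ Χ (corresponding s)) χ≃□Χs)
             (⇒-trans (modus-ponens (necessitation ⊢claim) (axiom-K ψ (⋀ agree)))
                      (⇒-trans (□-mono (⋀-elim agree s)) □-⇔))

  ψ⇔χ : ⊢ ψ ⇔ᶠ χ
  ψ⇔χ = ∧-intro (⇒-app (⇒-trans (⇒□-if-≃□ (Ψ s) ψ≃□Ψs) (⇒-trans □ψ⇒ψ⇔χ ∧-fst)) ⇒-refl)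
                (löb-rule (⇒-curry χ⇒ψ-under-□))
    where
    χ⇒ψ-under-□ : ⊢ □ᶠ (χ ⇒ᶠ ψ) ∧ᶠ χ ⇒ᶠ ψ
    χ⇒ψ-under-□ =
      ⇒-app (⇒-trans (⇒-app (⇒-trans ∧-fst (axiom-K χ ψ)) (⇒-trans ∧-snd (⇒□-if-≃□ (Χ (corresponding s)) χ≃□Χs)))
                     (⇒-trans □ψ⇒ψ⇔χ ∧-snd))
            ∧-snd

lemma4p5 : (ψ : Graph) → IsFormula ψ → label ψ (root ψ) ≡ lbox →
    (χ : Graph) → SubTop ψ χ → GL°⊢ (ψ ⇔ χ)
lemma4p5 ψ isF root-□ .(redirect otop ψ) (onCycle cyclic) =
  derivation (Agreement.ψ⇔χ (formula ψ (formula⇒guarded isF)) root-□ cyclic)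
lemma4p5 ψ isF root-□ .ψ (offCycle _) = derivation (⇔-refl {formula ψ (formula⇒guarded isF)})
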